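{- Every interval $[x,y]$ in $\mathcal{P}(n;\epsilon)$ is a supersolvable lattice.
   Context: A network on $n$ points is a set $E$ of pairs $(i,j)$ with $1\le i<j\le n$ (directed edges; $i$ a source, $j$ a sink) with no $(i,j),(j,k)\in E$, satisfying (B1): if $(i,k),(j,l)\in E$ with $i<j<k<l$ then $(j,k)\in E$. Let $\epsilon\in\{1,0,-1\}^n$ have first nonzero entry (if any) equal to $1$; $\mathcal{N}(n;\epsilon)$ is the set of such networks in which every source $i$ has $\epsilon_i=1$ and every sink $j$ has $\epsilon_j=-1$. $\mathcal{E}(x)$ is the edge set of $x$, $\rho(x)=|\mathcal{E}(x)|$; $x\lessdot y$ iff $\rho(y)=\rho(x)+1$ and $\mathcal{E}(x)\subset\mathcal{E}(y)$; $x\le y$ iff there is a chain of covers from $x$ to $y$; $\mathcal{P}(n;\epsilon)=(\mathcal{N}(n;\epsilon),\le)$. A finite lattice $L$ is supersolvable if it contains a maximal chain (an $M$-chain) which, together with any other chain of $L$, generates a distributive sublattice. -}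

module Defs where

open import Data.Nat using (ℕ; zero; suc; _+_)
open import Data.Bool using (Bool; true; false)
open import Data.Fin using (Fin; _<_)
open import Data.Vec using (Vec; []; _∷_; lookup)
open import Data.Product using (_×_; Σ; ∃)
open import Data.Sum using (_⊎_)
open import Data.Empty using (⊥)
open import Relation.Nullary using (¬_)
open import Relation.Binary.PropositionalEquality using (_≡_)
open import Relation.Binary.Construct.Closure.ReflexiveTransitive using (Star)

data Sign : Set where
  pos zer neg : Sign

FirstNonzeroPos : ∀ {n} → Vec Sign n → Set
FirstNonzeroPos {n} ε =
  ∀ (i : Fin n) → ¬ (lookup ε i ≡ zer) →
  (∀ (j : Fin n) → j < i → lookup ε j ≡ zer) → lookup ε i ≡ pos

-- Edge sets on points Fin n (point i+1 of the paper is Fin index i),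
-- encoded as a Boolean n×n matrix: entry (i,j) is true iff (i,j) ∈ E.

EdgeSet : ℕ → Set
EdgeSet n = Vec (Vec Bool n) n

edge : ∀ {n} → EdgeSet n → Fin n → Fin n → Bool
edge x i j = lookup (lookup x i) j

countRow : ∀ {m} → Vec Bool m → ℕ
countRow [] = 0
countRow (true ∷ r) = suc (countRow r)
countRow (false ∷ r) = countRow r

ρ : ∀ {n} → EdgeSet n → ℕ
ρ = go
  where
  go : ∀ {m k} → Vec (Vec Bool k) m → ℕ
  go [] = 0
  go (r ∷ rs) = countRow r + go rs

_⊆E_ : ∀ {n} → EdgeSet n → EdgeSet n → Set
_⊆E_ {n} x y = ∀ (i j : Fin n) → edge x i j ≡ true → edge y i j ≡ true

record IsNetwork {n : ℕ} (ε : Vec Sign n) (x : EdgeSet n) : Set where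
  field
    ordered  : ∀ i j → edge x i j ≡ true → i < j
    noPath   : ∀ i j k → edge x i j ≡ true → edge x j k ≡ true → ⊥
    B1       : ∀ i j k l → i < j → j < k → k < l →
               edge x i k ≡ true → edge x j l ≡ true → edge x j k ≡ true
    srcSign  : ∀ i j → edge x i j ≡ true → lookup ε i ≡ pos
    sinkSign : ∀ i j → edge x i j ≡ true → lookup ε j ≡ neg

record Cover {n : ℕ} (ε : Vec Sign n) (x y : EdgeSet n) : Set where
  field
    netˣ : IsNetwork ε x
    netʸ : IsNetwork ε y
    rank : ρ y ≡ suc (ρ x)
    sub  : x ⊆E y

Le : ∀ {n} (ε : Vec Sign n) → EdgeSet n → EdgeSet n → Set
Le ε = Star (Cover ε)

Interval : ∀ {n} (ε : Vec Sign n) → EdgeSet n → EdgeSet n → EdgeSet n → Set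
Interval ε x y z = IsNetwork ε z × Le ε x z × Le ε z y

module _ {A : Set} (_≤_ : A → A → Set) (S : A → Set) where

  IsJoin : A → A → A → Set
  IsJoin a b j = S j × a ≤ j × b ≤ j ×
                 (∀ z → S z → a ≤ z → b ≤ z → j ≤ z)

  IsMeet : A → A → A → Set
  IsMeet a b m = S m × m ≤ a × m ≤ b ×
                 (∀ z → S z → z ≤ a → z ≤ b → z ≤ m)

  IsLattice : Set
  IsLattice = ∀ a b → S a → S b → ∃ (IsJoin a b) × ∃ (IsMeet a b)

  IsChain : (A → Set) → Set
  IsChain C = (∀ a → C a → S a) ×
              (∀ a b → C a → C b → (a ≤ b) ⊎ (b ≤ a))

  IsMaximalChain : (A → Set) → Set
  IsMaximalChain C = IsChain C ×
    (∀ z → S z → (∀ c → C c → (c ≤ z) ⊎ (z ≤ c)) → C z)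

  data Generated (G : A → Set) : A → Set where
    base : ∀ {a} → G a → Generated G a
    join : ∀ {a b j} → Generated G a → Generated G b → IsJoin a b j →
           Generated G j
    meet : ∀ {a b m} → Generated G a → Generated G b → IsMeet a b m →
           Generated G m

  IsDistributive : (A → Set) → Set
  IsDistributive T = ∀ a b c d e f g h → T a → T b → T c →
    IsJoin b c d → IsMeet a d e →
    IsMeet a b f → IsMeet a c g → IsJoin f g h → e ≡ h

  IsSupersolvableLattice : Set₁
  IsSupersolvableLattice = IsLattice ×
    Σ (A → Set) λ M → IsMaximalChain M ×
      (∀ (C : A → Set) → IsChain C →
         IsDistributive (Generated (λ z → M z ⊎ C z)))

{-# OPTIONS --safe #-}

-- Between networks, ≤ is inclusion of edge sets: if a ⊆ b, adding to a the
-- ≺-least edge of b ∖ a (edges ordered by sink, then by decreasing source)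
-- keeps (B1), because the edge (j,k) that (B1) forces from (i,k) and (j,l)
-- precedes both. So meets in [x,y] are intersections, and joins exist by
-- finiteness. Adding the edges of y ∖ x to x one at a time in ≺-order gives a
-- maximal chain M: the z in [x,y] whose new edges z ∖ x form a ≺-initial
-- segment of y ∖ x. For any chain C, a union of blocks m ∩ c with m ∈ M and
-- c ∈ C ∪ {y} satisfies (B1), hence lies in [x,y]; such unions are closed
-- under ∪ and ∩, which are therefore their joins and meets. The sublattice
-- generated by M ∪ C consists of such unions, so it is distributive like every
-- lattice of sets.

module Submission where

open import Defs
open import Data.Nat using (ℕ; zero; suc; _+_; _≤_; z≤n; s≤s)
open import Data.Nat.Properties
  using (+-suc; +-mono-≤; m≤n⇒m≤1+n; m≤m+n; <-irrefl; ≤-trans; module ≤-Reasoning)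
open import Data.Bool using (Bool; true; false)
open import Data.Bool.Properties using (¬-not) renaming (_≟_ to _≟ᵇ_)
open import Data.Fin using (Fin; zero; suc; _<_; _>_)
open import Data.Fin.Properties using (_≟_; _<?_; <-cmp; all?; any?)
  renaming (<-trans to <ᶠ-trans; <-irrefl to <ᶠ-irrefl)
open import Data.Fin.Induction using (<-wellFounded; >-wellFounded)
open import Data.Vec using (Vec; []; _∷_; lookup; tabulate; _[_]%=_; _[_]≔_)
open import Data.Vec.Properties
  using ( lookup∘tabulate; tabulate∘lookup; tabulate-cong
        ; lookup∘updateAt; lookup∘updateAt′; lookup∘update; lookup∘update′)
open import Data.Product using (_×_; _,_; proj₁; proj₂; ∃; ∃₂; swap)
open import Data.Product.Relation.Binary.Pointwise.NonDependent using (≡×≡⇒≡)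
open import Data.Product.Relation.Binary.Lex.Strict
  using (×-Lex; ×-wellFounded; ×-transitive; ×-irreflexive; ×-compare; ×-decidable)
open import Data.Sum using (_⊎_; inj₁; inj₂; [_,_]′)
import Data.Sum as Sum
open import Function using (_on_; _∘_)
open import Relation.Nullary using (¬_; Dec; yes; no; does; contradiction)
open import Relation.Nullary.Decidable
  using (map′; _×-dec_; _⊎-dec_; _→-dec_; ¬?; dec-true; decidable-stable)
open import Relation.Binary.PropositionalEquality
  using (_≡_; refl; sym; trans; cong; subst; subst₂; isEquivalence; resp₂; module ≡-Reasoning)
open import Relation.Binary.Definitions using (Decidable; tri<; tri≈; tri>)
open import Relation.Binary.Construct.Closure.ReflexiveTransitive using (_◅_) renaming (ε to ε⋆)
import Relation.Binary.Construct.On as On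
import Relation.Binary.Construct.Flip.EqAndOrd as Flip
open import Induction.WellFounded using (Acc; acc; WellFounded)

private
  variable
    n k m : ℕ
    a b c z : EdgeSet n
    i j p q : Fin n

Edge : EdgeSet n → Fin n → Fin n → Set
Edge z i j = edge z i j ≡ true

Edge? : ∀ (z : EdgeSet n) i j → Dec (Edge z i j)
Edge? z i j = edge z i j ≟ᵇ true

⊆E-refl : ∀ (z : EdgeSet n) → z ⊆E z
⊆E-refl _ _ _ h = h

⊆E-trans : ∀ (a b c : EdgeSet n) → a ⊆E b → b ⊆E c → a ⊆E c
⊆E-trans _ _ _ a⊆b b⊆c i j h = b⊆c i j (a⊆b i j h)

lookup-ext : ∀ {A : Set} (xs ys : Vec A m) → (∀ i → lookup xs i ≡ lookup ys i) → xs ≡ ys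
lookup-ext xs ys h = trans (sym (tabulate∘lookup xs)) (trans (tabulate-cong h) (tabulate∘lookup ys))

⇔true⇒≡ : ∀ {u v : Bool} → (u ≡ true → v ≡ true) → (v ≡ true → u ≡ true) → u ≡ v
⇔true⇒≡ {true}  {true}  _ _ = refl
⇔true⇒≡ {true}  {false} f _ = sym (f refl)
⇔true⇒≡ {false} {true}  _ g = g refl
⇔true⇒≡ {false} {false} _ _ = refl

⊆E-antisym : ∀ (a b : EdgeSet n) → a ⊆E b → b ⊆E a → a ≡ b
⊆E-antisym a b a⊆b b⊆a =
  lookup-ext a b λ i → lookup-ext _ _ λ j → ⇔true⇒≡ (a⊆b i j) (b⊆a i j)

fromDec : {P : Fin n → Fin n → Set} → Decidable P → EdgeSet n
fromDec P? = tabulate λ i → tabulate λ j → does (P? i j)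

module _ {P : Fin n → Fin n → Set} (P? : Decidable P) where

  edge-fromDec : ∀ i j → edge (fromDec P?) i j ≡ does (P? i j)
  edge-fromDec i j =
    trans (cong (λ r → lookup r j) (lookup∘tabulate _ i)) (lookup∘tabulate _ j)

  fromDec⁺ : P i j → Edge (fromDec P?) i j
  fromDec⁺ {i} {j} pij = trans (edge-fromDec i j) (dec-true (P? i j) pij)

  fromDec⁻ : Edge (fromDec P?) i j → P i j
  fromDec⁻ {i} {j} h with P? i j | edge-fromDec i j
  ... | yes pij | _ = pij
  ... | no _ | edge≡false = contradiction (trans (sym edge≡false) h) λ ()

inBoth? : ∀ (a b : EdgeSet n) → Decidable λ i j → Edge a i j × Edge b i j
inBoth? a b i j = Edge? a i j ×-dec Edge? b i j

inEither? : ∀ (a b : EdgeSet n) → Decidable λ i j → Edge a i j ⊎ Edge b i j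
inEither? a b i j = Edge? a i j ⊎-dec Edge? b i j

_∩_ : EdgeSet n → EdgeSet n → EdgeSet n
a ∩ b = fromDec (inBoth? a b)

_∪_ : EdgeSet n → EdgeSet n → EdgeSet n
a ∪ b = fromDec (inEither? a b)

∩⁺ : ∀ (a b : EdgeSet n) → Edge a i j → Edge b i j → Edge (a ∩ b) i j
∩⁺ a b ai bi = fromDec⁺ (inBoth? a b) (ai , bi)

∩-⊆ˡ : ∀ (a b : EdgeSet n) → (a ∩ b) ⊆E a
∩-⊆ˡ a b _ _ = proj₁ ∘ fromDec⁻ (inBoth? a b)

∩-⊆ʳ : ∀ (a b : EdgeSet n) → (a ∩ b) ⊆E b
∩-⊆ʳ a b _ _ = proj₂ ∘ fromDec⁻ (inBoth? a b)

∪⁻ : ∀ (a b : EdgeSet n) → Edge (a ∪ b) i j → Edge a i j ⊎ Edge b i j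
∪⁻ a b = fromDec⁻ (inEither? a b)

⊆-∪ˡ : ∀ (a b : EdgeSet n) → a ⊆E (a ∪ b)
⊆-∪ˡ a b _ _ = fromDec⁺ (inEither? a b) ∘ inj₁

⊆-∪ʳ : ∀ (a b : EdgeSet n) → b ⊆E (a ∪ b)
⊆-∪ʳ a b _ _ = fromDec⁺ (inEither? a b) ∘ inj₂

⊆-∩ : ∀ (z a b : EdgeSet n) → z ⊆E a → z ⊆E b → z ⊆E (a ∩ b)
⊆-∩ _ a b z⊆a z⊆b i j h = ∩⁺ a b (z⊆a i j h) (z⊆b i j h)

∪-⊆ : ∀ (a b z : EdgeSet n) → a ⊆E z → b ⊆E z → (a ∪ b) ⊆E z
∪-⊆ a b _ a⊆z b⊆z i j h = [ a⊆z i j , b⊆z i j ]′ (∪⁻ a b h)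

∩-mono : ∀ (a a′ b b′ : EdgeSet n) → a ⊆E a′ → b ⊆E b′ → (a ∩ b) ⊆E (a′ ∩ b′)
∩-mono a a′ b b′ a⊆a′ b⊆b′ =
  ⊆-∩ (a ∩ b) a′ b′ (⊆E-trans (a ∩ b) a a′ (∩-⊆ˡ a b) a⊆a′)
                    (⊆E-trans (a ∩ b) b b′ (∩-⊆ʳ a b) b⊆b′)

∩-distribˡ-∪ : ∀ (a b c : EdgeSet n) → a ∩ (b ∪ c) ≡ (a ∩ b) ∪ (a ∩ c)
∩-distribˡ-∪ a b c = ⊆E-antisym _ _ distribute collect
  where
  distribute : (a ∩ (b ∪ c)) ⊆E ((a ∩ b) ∪ (a ∩ c))
  distribute i j h with ∪⁻ b c (∩-⊆ʳ a (b ∪ c) i j h)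
  ... | inj₁ bi = ⊆-∪ˡ (a ∩ b) (a ∩ c) i j (∩⁺ a b (∩-⊆ˡ a (b ∪ c) i j h) bi)
  ... | inj₂ ci = ⊆-∪ʳ (a ∩ b) (a ∩ c) i j (∩⁺ a c (∩-⊆ˡ a (b ∪ c) i j h) ci)
  collect : ((a ∩ b) ∪ (a ∩ c)) ⊆E (a ∩ (b ∪ c))
  collect = ∪-⊆ (a ∩ b) (a ∩ c) (a ∩ (b ∪ c)) (∩-mono a a b (b ∪ c) (⊆E-refl a) (⊆-∪ˡ b c))
                                            (∩-mono a a c (b ∪ c) (⊆E-refl a) (⊆-∪ʳ b c))

comparable-lower : {P : EdgeSet n → Set} → (∀ {a b} → P a → P b → a ⊆E b ⊎ b ⊆E a) →
  P a → P b → ∃ λ c → P c × c ⊆E a × c ⊆E b × (a ∩ b) ⊆E c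
comparable-lower {a = a} {b} comparable pa pb with comparable pa pb
... | inj₁ a⊆b = a , pa , ⊆E-refl a , a⊆b , ∩-⊆ˡ a b
... | inj₂ b⊆a = b , pb , b⊆a , ⊆E-refl b , ∩-⊆ʳ a b

insert : EdgeSet n → Fin n → Fin n → EdgeSet n
insert a i j = a [ i ]%= (_[ j ]≔ true)

edge-insert-new : ∀ (a : EdgeSet n) i j → Edge (insert a i j) i j
edge-insert-new a i j =
  trans (cong (λ r → lookup r j) (lookup∘updateAt i a)) (lookup∘update j (lookup a i) true)

edge-insert-old : ∀ (a : EdgeSet n) i j p q → ¬ (p ≡ i × q ≡ j) →
  edge (insert a i j) p q ≡ edge a p q
edge-insert-old a i j p q p,q≢i,j with p ≟ i | q ≟ j
... | yes refl | yes refl = contradiction (refl , refl) p,q≢i,j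
... | yes refl | no q≢j   =
  trans (cong (λ r → lookup r q) (lookup∘updateAt p a)) (lookup∘update′ q≢j (lookup a p) true)
... | no p≢i   | _        = cong (λ r → lookup r q) (lookup∘updateAt′ p i p≢i a)

insert⁻ : ∀ (a : EdgeSet n) i j → Edge (insert a i j) p q → Edge a p q ⊎ (p ≡ i × q ≡ j)
insert⁻ {p = p} {q} a i j h with (p ≟ i) ×-dec (q ≟ j)
... | yes p,q≡i,j = inj₂ p,q≡i,j
... | no p,q≢i,j  = inj₁ (trans (sym (edge-insert-old a i j p q p,q≢i,j)) h)

⊆-insert : ∀ (a : EdgeSet n) i j → a ⊆E insert a i j
⊆-insert a i j p q h with (p ≟ i) ×-dec (q ≟ j)
... | yes (refl , refl) = edge-insert-new a i j
... | no p,q≢i,j        = trans (edge-insert-old a i j p q p,q≢i,j) h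

insert-⊆ : ∀ (a b : EdgeSet n) → a ⊆E b → Edge b i j → insert a i j ⊆E b
insert-⊆ {i = i} {j} a b a⊆b bij p q h with insert⁻ a i j h
... | inj₁ apq          = a⊆b p q apq
... | inj₂ (refl , refl) = bij

-- ρ sums the rows with a helper hidden in a where block of Defs; rowTotal is
-- that helper, recovered by unification (abstracting suc n makes the
-- constraint a pattern).
mutual
  rowTotal : ∀ {k m} → Vec (Vec Bool k) m → ℕ
  rowTotal = _

  private
    ρ-∷ : ∀ {n} (r : Vec Bool (suc n)) rs → ρ (r ∷ rs) ≡ countRow r + rowTotal rs
    ρ-∷ {n} r rs with suc n
    ... | _ = refl

countRow-mono : ∀ (r s : Vec Bool k) →
  (∀ q → lookup r q ≡ true → lookup s q ≡ true) → countRow r ≤ countRow s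
countRow-mono []          []          _ = z≤n
countRow-mono (true ∷ r)  (true ∷ s)  h = s≤s (countRow-mono r s (h ∘ suc))
countRow-mono (true ∷ r)  (false ∷ s) h = contradiction (h zero refl) λ ()
countRow-mono (false ∷ r) (true ∷ s)  h = m≤n⇒m≤1+n (countRow-mono r s (h ∘ suc))
countRow-mono (false ∷ r) (false ∷ s) h = countRow-mono r s (h ∘ suc)

rowTotal-mono : ∀ (rs ss : Vec (Vec Bool k) m) →
  (∀ p q → lookup (lookup rs p) q ≡ true → lookup (lookup ss p) q ≡ true) →
  rowTotal rs ≤ rowTotal ss
rowTotal-mono []       []       _ = z≤n
rowTotal-mono (r ∷ rs) (s ∷ ss) h =
  +-mono-≤ (countRow-mono r s (h zero)) (rowTotal-mono rs ss (h ∘ suc))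

ρ-mono : ∀ (a b : EdgeSet n) → a ⊆E b → ρ a ≤ ρ b
ρ-mono = rowTotal-mono

countRow-[]≔true : ∀ (r : Vec Bool k) j → lookup r j ≡ false →
  countRow (r [ j ]≔ true) ≡ suc (countRow r)
countRow-[]≔true (false ∷ r) zero    refl = refl
countRow-[]≔true (true ∷ r)  (suc j) h    = cong suc (countRow-[]≔true r j h)
countRow-[]≔true (false ∷ r) (suc j) h    = countRow-[]≔true r j h

rowTotal-[]%= : ∀ (rs : Vec (Vec Bool k) m) i {f : Vec Bool k → Vec Bool k} →
  countRow (f (lookup rs i)) ≡ suc (countRow (lookup rs i)) →
  rowTotal (rs [ i ]%= f) ≡ suc (rowTotal rs)
rowTotal-[]%= (r ∷ rs) zero    h = cong (_+ rowTotal rs) h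
rowTotal-[]%= (r ∷ rs) (suc i) h =
  trans (cong (countRow r +_) (rowTotal-[]%= rs i h)) (+-suc (countRow r) (rowTotal rs))

ρ-insert : ∀ (a : EdgeSet n) i j → ¬ Edge a i j → ρ (insert a i j) ≡ suc (ρ a)
ρ-insert a i j ¬aij = rowTotal-[]%= a i (countRow-[]≔true (lookup a i) j (¬-not ¬aij))

Searchable : Set → Set₁
Searchable A = ∀ {P : A → Set} → (∀ a → Dec (P a)) → Dec (∀ a → P a)

Bool-searchable : Searchable Bool
Bool-searchable P? =
  map′ (λ (t , f) → λ { true → t ; false → f }) (λ ∀P → ∀P true , ∀P false)
       (P? true ×-dec P? false)

Vec-searchable : ∀ {A : Set} → Searchable A → ∀ m → Searchable (Vec A m)
Vec-searchable A-searchable zero    P? = map′ (λ { p [] → p }) (λ ∀P → ∀P []) (P? [])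
Vec-searchable A-searchable (suc m) P? =
  map′ (λ ∀P → λ { (a ∷ v) → ∀P a v }) (λ ∀P a v → ∀P (a ∷ v))
       (A-searchable λ a → Vec-searchable A-searchable m λ v → P? (a ∷ v))

EdgeSet-searchable : Searchable (EdgeSet n)
EdgeSet-searchable {n} = Vec-searchable (Vec-searchable Bool-searchable n) n

Pair : ℕ → Set
Pair n = Fin n × Fin n

∃-Pair? : {P : Pair n → Set} → (∀ e → Dec (P e)) → Dec (∃ P)
∃-Pair? P? = map′ (λ (i , j , pij) → (i , j) , pij) (λ ((i , j) , pij) → i , j , pij)
                  (any? λ i → any? λ j → P? (i , j))

_≺_ : Pair n → Pair n → Set
_≺_ = ×-Lex _≡_ _<_ _>_ on swap

≺-by-source : p < q → (q , i) ≺ (p , i)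
≺-by-source p<q = inj₂ (refl , p<q)

≺-by-sink : i < j → (q , i) ≺ (p , j)
≺-by-sink i<j = inj₁ i<j

≺-wellFounded : WellFounded (_≺_ {n})
≺-wellFounded = On.wellFounded swap (×-wellFounded <-wellFounded >-wellFounded)

_≺?_ : Decidable (_≺_ {n})
e ≺? e′ = ×-decidable _≟_ _<?_ (Flip.dec _<_ _<?_) (swap e) (swap e′)

≺-trans : ∀ {e₁ e₂ e₃ : Pair n} → e₁ ≺ e₂ → e₂ ≺ e₃ → e₁ ≺ e₃
≺-trans = ×-transitive {_≈₁_ = _≡_} {_<₁_ = _<_} {_<₂_ = _>_}
            isEquivalence (resp₂ _<_) <ᶠ-trans (Flip.trans _<_ <ᶠ-trans)

≺-irrefl : ∀ {e : Pair n} → ¬ e ≺ e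
≺-irrefl = ×-irreflexive {_≈₁_ = _≡_} {_<₁_ = _<_} {_≈₂_ = _≡_} {_<₂_ = _>_}
             <ᶠ-irrefl (Flip.irrefl _<_ sym <ᶠ-irrefl) (refl , refl)

≺-compare : ∀ (e e′ : Pair n) → e ≺ e′ ⊎ e ≡ e′ ⊎ e′ ≺ e
≺-compare e e′ with ×-compare {_≈₁_ = _≡_} {_<₁_ = _<_} {_≈₂_ = _≡_} {_<₂_ = _>_}
                      sym <-cmp (Flip.compare _<_ <-cmp) (swap e) (swap e′)
... | tri< e≺e′ _ _ = inj₁ e≺e′
... | tri≈ _ e≈e′ _ = inj₂ (inj₁ (cong swap (≡×≡⇒≡ e≈e′)))
... | tri> _ _ e′≺e = inj₂ (inj₂ e′≺e)

≺-minimal : {P : Pair n → Set} → (∀ e → Dec (P e)) → ∃ P →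
  ∃ λ e → P e × (∀ {e′} → P e′ → ¬ e′ ≺ e)
≺-minimal {P = P} P? (e , pe) = descend e (≺-wellFounded e) pe
  where
  descend : ∀ e → Acc _≺_ e → P e → ∃ λ e → P e × (∀ {e′} → P e′ → ¬ e′ ≺ e)
  descend e (acc below) pe with ∃-Pair? (λ e′ → P? e′ ×-dec e′ ≺? e)
  ... | yes (e′ , pe′ , e′≺e) = descend e′ (below e′≺e) pe′
  ... | no nothing-below      = e , pe , λ pe′ e′≺e → nothing-below (_ , pe′ , e′≺e)

_∖_ : EdgeSet n → EdgeSet n → Pair n → Set
(a ∖ b) e = Edge a (proj₁ e) (proj₂ e) × ¬ Edge b (proj₁ e) (proj₂ e)

∖? : ∀ (a b : EdgeSet n) e → Dec ((a ∖ b) e)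
∖? a b (i , j) = Edge? a i j ×-dec ¬? (Edge? b i j)

⊆E-or-∖ : ∀ (a b : EdgeSet n) → a ⊆E b ⊎ ∃ (a ∖ b)
⊆E-or-∖ a b with ∃-Pair? (∖? a b)
... | yes a∖b≢∅ = inj₂ a∖b≢∅
... | no a∖b≡∅  =
  inj₁ λ i j aij → decidable-stable (Edge? b i j) λ ¬bij → a∖b≡∅ ((i , j) , aij , ¬bij)

⊆E? : ∀ (a b : EdgeSet n) → Dec (a ⊆E b)
⊆E? a b = all? λ i → all? λ j → Edge? a i j →-dec Edge? b i j

IsB1 : EdgeSet n → Set
IsB1 z = ∀ i j k l → i < j → j < k → k < l → Edge z i k → Edge z j l → Edge z j k

IsB1? : ∀ (z : EdgeSet n) → Dec (IsB1 z)
IsB1? z = all? λ i → all? λ j → all? λ k → all? λ l →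
  i <? j →-dec j <? k →-dec k <? l →-dec Edge? z i k →-dec Edge? z j l →-dec Edge? z j k

B1-∩ : ∀ (a b : EdgeSet n) → IsB1 a → IsB1 b → IsB1 (a ∩ b)
B1-∩ a b B1a B1b i j k l i<j j<k k<l ik jl =
  ∩⁺ a b (B1a i j k l i<j j<k k<l (∩-⊆ˡ a b i k ik) (∩-⊆ˡ a b j l jl))
         (B1b i j k l i<j j<k k<l (∩-⊆ʳ a b i k ik) (∩-⊆ʳ a b j l jl))

insert-least-B1 : ∀ (a b : EdgeSet n) i j → IsB1 a → IsB1 b → a ⊆E b → Edge b i j →
  (∀ {e} → (b ∖ a) e → ¬ e ≺ (i , j)) → IsB1 (insert a i j)
insert-least-B1 a b i j B1a B1b a⊆b bij least p q r s p<q q<r r<s pr qs with Edge? a q r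
... | yes aqr = ⊆-insert a i j q r aqr
... | no ¬aqr with insert⁻ a i j pr | insert⁻ a i j qs
...   | inj₁ apr           | inj₁ aqs           = contradiction (B1a p q r s p<q q<r r<s apr aqs) ¬aqr
...   | inj₂ (refl , refl) | _                  = contradiction (≺-by-source p<q) (least (bqr , ¬aqr))
  where
  bqr : Edge b q r
  bqr = B1b p q r s p<q q<r r<s bij (insert-⊆ a b a⊆b bij q s qs)
...   | inj₁ apr           | inj₂ (refl , refl) = contradiction (≺-by-sink r<s) (least (bqr , ¬aqr))
  where
  bqr : Edge b q r
  bqr = B1b p q r s p<q q<r r<s (a⊆b p r apr) bij

module Networks {n} (ε : Vec Sign n) where

  network-⊆ : ∀ {b} (z : EdgeSet n) → IsNetwork ε b → z ⊆E b → IsB1 z → IsNetwork ε z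
  network-⊆ z b-net z⊆b B1z = record
    { ordered  = λ i j h → IsNetwork.ordered b-net i j (z⊆b i j h)
    ; noPath   = λ i j k h h′ → IsNetwork.noPath b-net i j k (z⊆b i j h) (z⊆b j k h′)
    ; B1       = B1z
    ; srcSign  = λ i j h → IsNetwork.srcSign b-net i j (z⊆b i j h)
    ; sinkSign = λ i j h → IsNetwork.sinkSign b-net i j (z⊆b i j h)
    }

  Le⇒⊆ : Le ε a b → a ⊆E b
  Le⇒⊆ {a = a} ε⋆ = ⊆E-refl a
  Le⇒⊆ {a = a} {b} (_◅_ {j = a′} a⋖a′ a′≤b) =
    ⊆E-trans a a′ b (Cover.sub a⋖a′) (Le⇒⊆ a′≤b)

  Le-antisym : Le ε a b → Le ε b a → a ≡ b
  Le-antisym {a = a} {b} a≤b b≤a = ⊆E-antisym a b (Le⇒⊆ a≤b) (Le⇒⊆ b≤a)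

  least-missing-cover : IsNetwork ε a → IsNetwork ε b → a ⊆E b → (b ∖ a) (i , j) →
    (∀ {e} → (b ∖ a) e → ¬ e ≺ (i , j)) → Cover ε a (insert a i j)
  least-missing-cover {a = a} {b = b} {i = i} {j} a-net b-net a⊆b (bij , ¬aij) least = record
    { netˣ = a-net
    ; netʸ = network-⊆ (insert a i j) b-net (insert-⊆ a b a⊆b bij)
               (insert-least-B1 a b i j (IsNetwork.B1 a-net) (IsNetwork.B1 b-net) a⊆b bij least)
    ; rank = ρ-insert a i j ¬aij
    ; sub  = ⊆-insert a i j
    }

  cover-toward : IsNetwork ε a → IsNetwork ε b → a ⊆E b →
    a ≡ b ⊎ ∃ λ a′ → Cover ε a a′ × a′ ⊆E b
  cover-toward {a = a} {b = b} a-net b-net a⊆b with ⊆E-or-∖ b a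
  ... | inj₁ b⊆a    = inj₁ (⊆E-antisym a b a⊆b b⊆a)
  ... | inj₂ b∖a≢∅ with ≺-minimal (∖? b a) b∖a≢∅
  ...   | (i , j) , (bij , ¬aij) , least =
    inj₂ (insert a i j , least-missing-cover a-net b-net a⊆b (bij , ¬aij) least , insert-⊆ a b a⊆b bij)

  ⊆⇒Le : IsNetwork ε a → IsNetwork ε b → a ⊆E b → Le ε a b
  ⊆⇒Le {a = a} {b = b} a-net b-net a⊆b = grow (ρ b) a-net a⊆b (m≤m+n (ρ b) (ρ a))
    where
    grow : ∀ fuel {a} → IsNetwork ε a → a ⊆E b → ρ b ≤ fuel + ρ a → Le ε a b
    grow fuel {a} a-net a⊆b ρb≤ with cover-toward a-net b-net a⊆b
    ... | inj₁ refl = ε⋆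
    ... | inj₂ (a′ , a⋖a′ , a′⊆b) with fuel
    ...   | zero     = contradiction (≤-trans ρa<ρb ρb≤) (<-irrefl refl)
      where
      ρa<ρb : suc (ρ a) ≤ ρ b
      ρa<ρb = subst (_≤ ρ b) (Cover.rank a⋖a′) (ρ-mono a′ b a′⊆b)
    ...   | suc fuel = a⋖a′ ◅ grow fuel (Cover.netʸ a⋖a′) a′⊆b ρb≤fuel+ρa′
      where
      open ≤-Reasoning
      ρb≤fuel+ρa′ : ρ b ≤ fuel + ρ a′
      ρb≤fuel+ρa′ = begin
        ρ b                ≤⟨ ρb≤ ⟩
        suc fuel + ρ a     ≡⟨ +-suc fuel (ρ a) ⟨
        fuel + suc (ρ a)   ≡⟨ cong (fuel +_) (Cover.rank a⋖a′) ⟨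
        fuel + ρ a′        ∎

  meet-unique : {S : EdgeSet n → Set} {m m′ : EdgeSet n} →
    IsMeet (Le ε) S a b m → IsMeet (Le ε) S a b m′ → m ≡ m′
  meet-unique (sm , m≤a , m≤b , greatest) (sm′ , m′≤a , m′≤b , greatest′) =
    Le-antisym (greatest′ _ sm m≤a m≤b) (greatest _ sm′ m′≤a m′≤b)

  join-unique : {S : EdgeSet n → Set} {j j′ : EdgeSet n} →
    IsJoin (Le ε) S a b j → IsJoin (Le ε) S a b j′ → j ≡ j′
  join-unique (sj , a≤j , b≤j , least) (sj′ , a≤j′ , b≤j′ , least′) =
    Le-antisym (least _ sj′ a≤j′ b≤j′) (least′ _ sj a≤j b≤j)

module IntervalLattice {n} (ε : Vec Sign n) (x y : EdgeSet n)
  (x-net : IsNetwork ε x) (y-net : IsNetwork ε y) (x≤y : Le ε x y) where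

  open Networks ε

  I : EdgeSet n → Set
  I = Interval ε x y

  I-network : I z → IsNetwork ε z
  I-network = proj₁

  I-B1 : I z → IsB1 z
  I-B1 = IsNetwork.B1 ∘ proj₁

  I-lower : I z → x ⊆E z
  I-lower (_ , x≤z , _) = Le⇒⊆ x≤z

  I-upper : I z → z ⊆E y
  I-upper (_ , _ , z≤y) = Le⇒⊆ z≤y

  I⁺ : ∀ z → x ⊆E z → z ⊆E y → IsB1 z → I z
  I⁺ z x⊆z z⊆y B1z = z-net , ⊆⇒Le x-net z-net x⊆z , ⊆⇒Le z-net y-net z⊆y
    where
    z-net : IsNetwork ε z
    z-net = network-⊆ z y-net z⊆y B1z

  y∈I : I y
  y∈I = y-net , x≤y , ε⋆

  ⊆⇒Leᴵ : I a → I b → a ⊆E b → Le ε a b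
  ⊆⇒Leᴵ a∈I b∈I = ⊆⇒Le (I-network a∈I) (I-network b∈I)

  ∩∈I : I a → I b → I (a ∩ b)
  ∩∈I {a = a} {b} a∈I b∈I =
    I⁺ (a ∩ b) (⊆-∩ x a b (I-lower a∈I) (I-lower b∈I))
       (⊆E-trans (a ∩ b) a y (∩-⊆ˡ a b) (I-upper a∈I)) (B1-∩ a b (I-B1 a∈I) (I-B1 b∈I))

  ∩-isMeet : I a → I b → IsMeet (Le ε) I a b (a ∩ b)
  ∩-isMeet {a = a} {b} a∈I b∈I =
    a∩b∈I , ⊆⇒Leᴵ a∩b∈I a∈I (∩-⊆ˡ a b) , ⊆⇒Leᴵ a∩b∈I b∈I (∩-⊆ʳ a b) ,
    λ z z∈I z≤a z≤b → ⊆⇒Leᴵ z∈I a∩b∈I (⊆-∩ z a b (Le⇒⊆ z≤a) (Le⇒⊆ z≤b))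
    where
    a∩b∈I : I (a ∩ b)
    a∩b∈I = ∩∈I a∈I b∈I

  ∪-isJoin : I a → I b → I (a ∪ b) → IsJoin (Le ε) I a b (a ∪ b)
  ∪-isJoin {a = a} {b} a∈I b∈I a∪b∈I =
    a∪b∈I , ⊆⇒Leᴵ a∈I a∪b∈I (⊆-∪ˡ a b) , ⊆⇒Leᴵ b∈I a∪b∈I (⊆-∪ʳ a b) ,
    λ z z∈I a≤z b≤z → ⊆⇒Leᴵ a∪b∈I z∈I (∪-⊆ a b z (Le⇒⊆ a≤z) (Le⇒⊆ b≤z))

  UpperBound : EdgeSet n → EdgeSet n → EdgeSet n → Set
  UpperBound a b z = a ⊆E z × b ⊆E z × z ⊆E y × IsB1 z

  UpperBound? : ∀ a b z → Dec (UpperBound a b z)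
  UpperBound? a b z = ⊆E? a z ×-dec ⊆E? b z ×-dec ⊆E? z y ×-dec IsB1? z

  inAllUpperBounds? : ∀ a b → Decidable λ i j → ∀ z → UpperBound a b z → Edge z i j
  inAllUpperBounds? a b i j = EdgeSet-searchable λ z → UpperBound? a b z →-dec Edge? z i j

  lub : EdgeSet n → EdgeSet n → EdgeSet n
  lub a b = fromDec (inAllUpperBounds? a b)

  lub-least : ∀ a b z → UpperBound a b z → lub a b ⊆E z
  lub-least a b z ub i j h = fromDec⁻ (inAllUpperBounds? a b) h z ub

  lub⁺ : ∀ a b → (∀ z → UpperBound a b z → Edge z i j) → Edge (lub a b) i j
  lub⁺ a b = fromDec⁺ (inAllUpperBounds? a b)

  lub-isJoin : I a → I b → IsJoin (Le ε) I a b (lub a b)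
  lub-isJoin {a = a} {b} a∈I b∈I =
    lub∈I , ⊆⇒Leᴵ a∈I lub∈I a⊆lub , ⊆⇒Leᴵ b∈I lub∈I b⊆lub ,
    λ z z∈I a≤z b≤z →
      ⊆⇒Leᴵ lub∈I z∈I (lub-least a b z (Le⇒⊆ a≤z , Le⇒⊆ b≤z , I-upper z∈I , I-B1 z∈I))
    where
    a⊆lub : a ⊆E lub a b
    a⊆lub i j aij = lub⁺ a b λ z (a⊆z , _) → a⊆z i j aij
    b⊆lub : b ⊆E lub a b
    b⊆lub i j bij = lub⁺ a b λ z (_ , b⊆z , _) → b⊆z i j bij
    B1-lub : IsB1 (lub a b)
    B1-lub i j k l i<j j<k k<l ik jl = lub⁺ a b λ z ub →
      proj₂ (proj₂ (proj₂ ub)) i j k l i<j j<k k<l (lub-least a b z ub i k ik) (lub-least a b z ub j l jl)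
    lub∈I : I (lub a b)
    lub∈I = I⁺ (lub a b) (⊆E-trans x a (lub a b) (I-lower a∈I) a⊆lub)
               (lub-least a b y (I-upper a∈I , I-upper b∈I , ⊆E-refl y , IsNetwork.B1 y-net)) B1-lub

  lattice : IsLattice (Le ε) I
  lattice a b a∈I b∈I = (lub a b , lub-isJoin a∈I b∈I) , (a ∩ b , ∩-isMeet a∈I b∈I)

  isMeet⇒≡∩ : ∀ {m} → I a → I b → IsMeet (Le ε) I a b m → m ≡ a ∩ b
  isMeet⇒≡∩ a∈I b∈I a∧b = meet-unique a∧b (∩-isMeet a∈I b∈I)

  x∈I : I x
  x∈I = x-net , ε⋆ , x≤y

  InitialSegment : EdgeSet n → Set
  InitialSegment z =
    ∀ {i j k l} → Edge z i j → ¬ Edge x i j → Edge y k l → (k , l) ≺ (i , j) → Edge z k l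

  M : EdgeSet n → Set
  M z = I z × InitialSegment z

  module _ {p q r s : Fin n} (p<q : p < q) (q<r : q < r) (r<s : r < s) where

    forced : I z → Edge z p r → Edge z q s → Edge z q r
    forced z∈I = I-B1 z∈I p q r s p<q q<r r<s

    forced-in-y : I a → I b → Edge a p r → Edge b q s → Edge y q r
    forced-in-y a∈I b∈I pr qs = forced y∈I (I-upper a∈I p r pr) (I-upper b∈I q s qs)

    initialSegment-forced : ∀ z → x ⊆E z → z ⊆E y → InitialSegment z →
      Edge z p r → Edge z q s → Edge z q r
    initialSegment-forced z x⊆z z⊆y seg pr qs
      with Edge? x p r | Edge? x q s | forced y∈I (z⊆y p r pr) (z⊆y q s qs)
    ... | no ¬xpr | _       | yqr = seg pr ¬xpr yqr (≺-by-source p<q)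
    ... | yes _   | no ¬xqs | yqr = seg qs ¬xqs yqr (≺-by-sink r<s)
    ... | yes xpr | yes xqs | _   = x⊆z q r (forced x∈I xpr xqs)

    -- Only the order of c₁ and c₂ matters: when (B1) cannot be applied inside
    -- a single block, the initial-segment property of m₁ or m₂ supplies (q,r).
    blocks-forced : ∀ {m₁ m₂ c₁ c₂} → M m₁ → M m₂ → I c₁ → I c₂ → c₁ ⊆E c₂ ⊎ c₂ ⊆E c₁ →
      Edge m₁ p r → Edge c₁ p r → Edge m₂ q s → Edge c₂ q s →
      (Edge m₁ q r × Edge c₁ q r) ⊎ (Edge m₂ q r × Edge c₂ q r)
    blocks-forced (m₁∈I , _) (m₂∈I , seg₂) c₁∈I c₂∈I (inj₁ c₁⊆c₂) m₁pr c₁pr m₂qs c₂qs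
      with Edge? x q s
    ... | yes xqs = inj₁ (forced m₁∈I m₁pr (I-lower m₁∈I q s xqs) ,
                          forced c₁∈I c₁pr (I-lower c₁∈I q s xqs))
    ... | no ¬xqs = inj₂ (seg₂ m₂qs ¬xqs (forced-in-y m₁∈I m₂∈I m₁pr m₂qs) (≺-by-sink r<s) ,
                          forced c₂∈I (c₁⊆c₂ p r c₁pr) c₂qs)
    blocks-forced (m₁∈I , seg₁) (m₂∈I , _) c₁∈I c₂∈I (inj₂ c₂⊆c₁) m₁pr c₁pr m₂qs c₂qs
      with Edge? x p r
    ... | yes xpr = inj₂ (forced m₂∈I (I-lower m₂∈I p r xpr) m₂qs ,
                          forced c₂∈I (I-lower c₂∈I p r xpr) c₂qs)
    ... | no ¬xpr = inj₁ (seg₁ m₁pr ¬xpr (forced-in-y m₁∈I m₂∈I m₁pr m₂qs) (≺-by-source p<q) ,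
                          forced c₁∈I c₁pr (c₂⊆c₁ q s c₂qs))

  initialSegment-B1 : ∀ z → x ⊆E z → z ⊆E y → InitialSegment z → IsB1 z
  initialSegment-B1 z x⊆z z⊆y seg p q r s p<q q<r r<s =
    initialSegment-forced p<q q<r r<s z x⊆z z⊆y seg

  y∈M : M y
  y∈M = y∈I , λ _ _ ykl _ → ykl

  M-comparable : M a → M b → a ⊆E b ⊎ b ⊆E a
  M-comparable {a = a} {b} (a∈I , seg-a) (b∈I , seg-b) with ⊆E-or-∖ a b
  ... | inj₁ a⊆b                    = inj₁ a⊆b
  ... | inj₂ ((i , j) , aij , ¬bij) = inj₂ b⊆a
    where
    b⊆a : b ⊆E a
    b⊆a k l bkl with Edge? a k l | ≺-compare (k , l) (i , j)
    ... | yes akl | _                 = akl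
    ... | no _    | inj₁ kl≺ij        = seg-a aij (¬bij ∘ I-lower b∈I i j) (I-upper b∈I k l bkl) kl≺ij
    ... | no _    | inj₂ (inj₁ refl)  = contradiction bkl ¬bij
    ... | no ¬akl | inj₂ (inj₂ ij≺kl) =
      contradiction (seg-b bkl (¬akl ∘ I-lower a∈I k l) (I-upper a∈I i j aij) ij≺kl) ¬bij

  inSegment? : ∀ t → Decidable λ i j → Edge x i j ⊎ (Edge y i j × (i , j) ≺ t)
  inSegment? t i j = Edge? x i j ⊎-dec (Edge? y i j ×-dec (i , j) ≺? t)

  segment : Pair n → EdgeSet n
  segment t = fromDec (inSegment? t)

  segment⁺ : ∀ t → Edge x i j ⊎ (Edge y i j × (i , j) ≺ t) → Edge (segment t) i j
  segment⁺ t = fromDec⁺ (inSegment? t)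

  segment⁻ : ∀ t → Edge (segment t) i j → Edge x i j ⊎ (Edge y i j × (i , j) ≺ t)
  segment⁻ t = fromDec⁻ (inSegment? t)

  segment∈M : ∀ t → M (segment t)
  segment∈M t =
    I⁺ (segment t) x⊆seg seg⊆y (initialSegment-B1 (segment t) x⊆seg seg⊆y initial) , initial
    where
    x⊆seg : x ⊆E segment t
    x⊆seg i j xij = segment⁺ t (inj₁ xij)
    seg⊆y : segment t ⊆E y
    seg⊆y i j h = [ Le⇒⊆ x≤y i j , proj₁ ]′ (segment⁻ t h)
    initial : InitialSegment (segment t)
    initial h ¬xij ykl kl≺ij with segment⁻ t h
    ... | inj₁ xij        = contradiction xij ¬xij
    ... | inj₂ (_ , ij≺t) = segment⁺ t (inj₂ (ykl , ≺-trans kl≺ij ij≺t))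

  M-maximal : I z → (∀ c → M c → Le ε c z ⊎ Le ε z c) → M z
  M-maximal {z = z} z∈I comparable = z∈I , initial
    where
    initial : InitialSegment z
    initial {i} {j} {k} {l} zij ¬xij ykl kl≺ij with comparable (segment (i , j)) (segment∈M (i , j))
    ... | inj₁ seg≤z = Le⇒⊆ seg≤z k l (segment⁺ (i , j) (inj₂ (ykl , kl≺ij)))
    ... | inj₂ z≤seg with segment⁻ (i , j) (Le⇒⊆ z≤seg i j zij)
    ...   | inj₁ xij          = contradiction xij ¬xij
    ...   | inj₂ (_ , ij≺ij)  = contradiction ij≺ij ≺-irrefl

  M-isChain : IsChain (Le ε) I M
  M-isChain = (λ _ → proj₁) , λ _ _ a∈M@(a∈I , _) b∈M@(b∈I , _) →
    Sum.map (⊆⇒Leᴵ a∈I b∈I) (⊆⇒Leᴵ b∈I a∈I) (M-comparable a∈M b∈M)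

  M-isMaximalChain : IsMaximalChain (Le ε) I M
  M-isMaximalChain = M-isChain , λ _ → M-maximal

  module _ (C : EdgeSet n → Set) (C-chain : IsChain (Le ε) I C) where

    -- Adjoining y to C makes every element m of M a block m ∩ y.
    C⁺ : EdgeSet n → Set
    C⁺ c = C c ⊎ c ≡ y

    C⁺-I : C⁺ c → I c
    C⁺-I (inj₁ c∈C) = proj₁ C-chain _ c∈C
    C⁺-I (inj₂ refl) = y∈I

    C⁺-comparable : C⁺ a → C⁺ b → a ⊆E b ⊎ b ⊆E a
    C⁺-comparable (inj₁ a∈C) (inj₁ b∈C) = Sum.map Le⇒⊆ Le⇒⊆ (proj₂ C-chain _ _ a∈C b∈C)
    C⁺-comparable a∈C⁺ (inj₂ refl) = inj₁ (I-upper (C⁺-I a∈C⁺))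
    C⁺-comparable (inj₂ refl) b∈C⁺ = inj₂ (I-upper (C⁺-I b∈C⁺))

    InBlock : EdgeSet n → Fin n → Fin n → Set
    InBlock z i j = ∃₂ λ m c → M m × C⁺ c × Edge m i j × Edge c i j × (m ∩ c) ⊆E z

    BlockUnion : EdgeSet n → Set
    BlockUnion z = x ⊆E z × (∀ i j → Edge z i j → InBlock z i j)

    InBlock-mono : ∀ a b → a ⊆E b → InBlock a i j → InBlock b i j
    InBlock-mono a b a⊆b (m , c , m∈M , c∈C⁺ , mij , cij , block⊆a) =
      m , c , m∈M , c∈C⁺ , mij , cij , ⊆E-trans (m ∩ c) a b block⊆a a⊆b

    InBlock-∩ : ∀ a b → InBlock a i j → InBlock b i j → InBlock (a ∩ b) i j
    InBlock-∩ {i = i} {j} a b (m₁ , c₁ , m₁∈M , c₁∈C⁺ , m₁ij , c₁ij , block₁⊆a)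
                              (m₂ , c₂ , m₂∈M , c₂∈C⁺ , m₂ij , c₂ij , block₂⊆b)
      with comparable-lower M-comparable m₁∈M m₂∈M | comparable-lower C⁺-comparable c₁∈C⁺ c₂∈C⁺
    ... | m , m∈M , m⊆m₁ , m⊆m₂ , m₁∩m₂⊆m | c , c∈C⁺ , c⊆c₁ , c⊆c₂ , c₁∩c₂⊆c =
      m , c , m∈M , c∈C⁺ ,
      m₁∩m₂⊆m i j (∩⁺ m₁ m₂ m₁ij m₂ij) , c₁∩c₂⊆c i j (∩⁺ c₁ c₂ c₁ij c₂ij) ,
      ⊆-∩ (m ∩ c) a b (⊆E-trans (m ∩ c) (m₁ ∩ c₁) a (∩-mono m m₁ c c₁ m⊆m₁ c⊆c₁) block₁⊆a)
                      (⊆E-trans (m ∩ c) (m₂ ∩ c₂) b (∩-mono m m₂ c c₂ m⊆m₂ c⊆c₂) block₂⊆b)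

    BlockUnion-∪ : ∀ a b → BlockUnion a → BlockUnion b → BlockUnion (a ∪ b)
    BlockUnion-∪ a b (x⊆a , blocks-a) (_ , blocks-b) =
      ⊆E-trans x a (a ∪ b) x⊆a (⊆-∪ˡ a b) ,
      λ i j h → [ InBlock-mono a (a ∪ b) (⊆-∪ˡ a b) ∘ blocks-a i j
                , InBlock-mono b (a ∪ b) (⊆-∪ʳ a b) ∘ blocks-b i j ]′ (∪⁻ a b h)

    BlockUnion-∩ : ∀ a b → BlockUnion a → BlockUnion b → BlockUnion (a ∩ b)
    BlockUnion-∩ a b (x⊆a , blocks-a) (x⊆b , blocks-b) =
      ⊆-∩ x a b x⊆a x⊆b ,
      λ i j h → InBlock-∩ a b (blocks-a i j (∩-⊆ˡ a b i j h)) (blocks-b i j (∩-⊆ʳ a b i j h))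

    BlockUnion-⊆y : ∀ z → BlockUnion z → z ⊆E y
    BlockUnion-⊆y z (_ , blocks) i j zij with blocks i j zij
    ... | _ , _ , (m∈I , _) , _ , mij , _ = I-upper m∈I i j mij

    BlockUnion-B1 : ∀ z → BlockUnion z → IsB1 z
    BlockUnion-B1 z (_ , blocks) p q r s p<q q<r r<s zpr zqs
      with blocks p r zpr | blocks q s zqs
    ... | m₁ , c₁ , m₁∈M , c₁∈C⁺ , m₁pr , c₁pr , block₁⊆z
        | m₂ , c₂ , m₂∈M , c₂∈C⁺ , m₂qs , c₂qs , block₂⊆z =
      [ (λ (m₁qr , c₁qr) → block₁⊆z q r (∩⁺ m₁ c₁ m₁qr c₁qr))
      , (λ (m₂qr , c₂qr) → block₂⊆z q r (∩⁺ m₂ c₂ m₂qr c₂qr)) ]′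
      (blocks-forced p<q q<r r<s m₁∈M m₂∈M (C⁺-I c₁∈C⁺) (C⁺-I c₂∈C⁺) (C⁺-comparable c₁∈C⁺ c₂∈C⁺)
                     m₁pr c₁pr m₂qs c₂qs)

    BlockUnion-I : ∀ z → BlockUnion z → I z
    BlockUnion-I z z-blocks =
      I⁺ z (proj₁ z-blocks) (BlockUnion-⊆y z z-blocks) (BlockUnion-B1 z z-blocks)

    isJoin⇒≡∪ : ∀ a b {j} → BlockUnion a → BlockUnion b → IsJoin (Le ε) I a b j → j ≡ a ∪ b
    isJoin⇒≡∪ a b a-blocks b-blocks a∨b =
      join-unique a∨b (∪-isJoin (BlockUnion-I a a-blocks) (BlockUnion-I b b-blocks)
                                (BlockUnion-I (a ∪ b) (BlockUnion-∪ a b a-blocks b-blocks)))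

    Gen : EdgeSet n → Set
    Gen = Generated (Le ε) I (λ z → M z ⊎ C z)

    generated⇒BlockUnion : Gen z → BlockUnion z
    generated⇒BlockUnion {z = z} (base (inj₁ z∈M@(z∈I , _))) =
      I-lower z∈I , λ i j zij → z , y , z∈M , inj₂ refl , zij , I-upper z∈I i j zij , ∩-⊆ˡ z y
    generated⇒BlockUnion {z = z} (base (inj₂ z∈C)) =
      I-lower z∈I , λ i j zij → y , z , y∈M , inj₁ z∈C , I-upper z∈I i j zij , zij , ∩-⊆ʳ y z
      where
      z∈I : I z
      z∈I = proj₁ C-chain z z∈C
    generated⇒BlockUnion (join {a} {b} a∈G b∈G a∨b) =
      subst BlockUnion (sym (isJoin⇒≡∪ a b a-blocks b-blocks a∨b)) (BlockUnion-∪ a b a-blocks b-blocks)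
      where
      a-blocks : BlockUnion a
      a-blocks = generated⇒BlockUnion a∈G
      b-blocks : BlockUnion b
      b-blocks = generated⇒BlockUnion b∈G
    generated⇒BlockUnion (meet {a} {b} a∈G b∈G a∧b) =
      subst BlockUnion (sym (isMeet⇒≡∩ (BlockUnion-I a a-blocks) (BlockUnion-I b b-blocks) a∧b))
            (BlockUnion-∩ a b a-blocks b-blocks)
      where
      a-blocks : BlockUnion a
      a-blocks = generated⇒BlockUnion a∈G
      b-blocks : BlockUnion b
      b-blocks = generated⇒BlockUnion b∈G

    generated-distributive : IsDistributive (Le ε) I Gen
    generated-distributive a b c d e f g h a∈G b∈G c∈G b∨c a∧d a∧b a∧c f∨g = begin
      e                 ≡⟨ isMeet⇒≡∩ a∈I (proj₁ b∨c) a∧d ⟩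
      a ∩ d             ≡⟨ cong (a ∩_) (isJoin⇒≡∪ b c b-blocks c-blocks b∨c) ⟩
      a ∩ (b ∪ c)       ≡⟨ ∩-distribˡ-∪ a b c ⟩
      (a ∩ b) ∪ (a ∩ c) ≡⟨ isJoin⇒≡∪ (a ∩ b) (a ∩ c) a∩b-blocks a∩c-blocks a∩b∨a∩c ⟨
      h                 ∎
      where
      open ≡-Reasoning
      a-blocks : BlockUnion a
      a-blocks = generated⇒BlockUnion a∈G
      b-blocks : BlockUnion b
      b-blocks = generated⇒BlockUnion b∈G
      c-blocks : BlockUnion c
      c-blocks = generated⇒BlockUnion c∈G
      a∩b-blocks : BlockUnion (a ∩ b)
      a∩b-blocks = BlockUnion-∩ a b a-blocks b-blocks
      a∩c-blocks : BlockUnion (a ∩ c)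
      a∩c-blocks = BlockUnion-∩ a c a-blocks c-blocks
      a∈I : I a
      a∈I = BlockUnion-I a a-blocks
      a∩b∨a∩c : IsJoin (Le ε) I (a ∩ b) (a ∩ c) h
      a∩b∨a∩c = subst₂ (λ f g → IsJoin (Le ε) I f g h)
                       (isMeet⇒≡∩ a∈I (BlockUnion-I b b-blocks) a∧b)
                       (isMeet⇒≡∩ a∈I (BlockUnion-I c c-blocks) a∧c) f∨g

-- The normalisation of ε (first nonzero entry positive) plays no role.
corollary5p12 : (n : ℕ) (ε : Vec Sign n) → FirstNonzeroPos ε →
    (x y : EdgeSet n) → IsNetwork ε x → IsNetwork ε y → Le ε x y →
    IsSupersolvableLattice (Le ε) (Interval ε x y)
corollary5p12 n ε _ x y x-net y-net x≤y =
  lattice , M , M-isMaximalChain , generated-distributive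
  where open IntervalLattice ε x y x-net y-net x≤y
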